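{- Let $m,n$ be positive integers with $m\ge n$. Then \[ (-1)^{m+n} = \sum_{k=0}^{n}\binom{m+k}{k}\binom{m}{k}\binom{n+k}{k}\binom{n}{k}\Big[1+k\big(H^{(1)}_{m+k}+H^{(1)}_{m-k}+H^{(1)}_{n+k}+H^{(1)}_{n-k}-4H^{(1)}_k\big)\Big] + \sum_{k=n+1}^{m}(-1)^{k-n}\binom{m+k}{k}\binom{m}{k}\binom{n+k}{k}\Big/\binom{k-1}{n}. \]
   Context: Generalised harmonic sums: $H^{(i)}_n=\sum_{j=1}^n j^{ -i}$ for $n\ge1$ and $H^{(i)}_0=0$. -}

module Defs where

open import Data.Nat as ℕ using (ℕ; zero; suc; _∸_)
open import Data.Nat.Combinatorics using (_C_)
open import Data.Integer using (+_)
open import Data.Rational using (ℚ; 0ℚ; 1ℚ; _+_; _*_; -_; _/_)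
open import Data.List using (List; map; upTo; foldr)

⟦_⟧ : ℕ → ℚ
⟦ n ⟧ = + n / 1

H : ℕ → ℚ
H zero    = 0ℚ
H (suc n) = H n + (+ 1 / suc n)

neg1^ : ℕ → ℚ
neg1^ zero    = 1ℚ
neg1^ (suc n) = - neg1^ n

-- Σ_{k=a}^{b} f k  (empty when b < a)
sumFromTo : ℕ → ℕ → (ℕ → ℚ) → ℚ
sumFromTo a b f = foldr _+_ 0ℚ (map (λ i → f (a ℕ.+ i)) (upTo (suc b ∸ a)))

-- q / d for a natural d; the value for d = 0 is a dummy (0) and is never
-- used in the statement (all denominators there are nonzero).
_÷ℕ_ : ℚ → ℕ → ℚ
q ÷ℕ zero  = 0ℚ
q ÷ℕ suc d = q * (+ 1 / suc d)

term1 : ℕ → ℕ → ℕ → ℚ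
term1 m n k =
  ⟦ ((m ℕ.+ k) C k) ℕ.* (m C k) ℕ.* ((n ℕ.+ k) C k) ℕ.* (n C k) ⟧ *
  (1ℚ + ⟦ k ⟧ * (H (m ℕ.+ k) + H (m ∸ k) + H (n ℕ.+ k) + H (n ∸ k) - ⟦ 4 ⟧ * H k))
  where open import Data.Rational using (_-_)

term2 : ℕ → ℕ → ℕ → ℚ
term2 m n k =
  (neg1^ (k ∸ n) * ⟦ ((m ℕ.+ k) C k) ℕ.* (m C k) ℕ.* ((n ℕ.+ k) C k) ⟧) ÷ℕ ((k ∸ 1) C n)

-- Let c n j = (-1)^(n-j) C(n+j,j) C(n,j), the coefficients of the shifted Legendre polynomial,
-- so that ∑ⱼ c n j = 1.  They are also the residues of V n x = ∏_{i=1}^n (x+i) / ∏_{i=0}^n (x-i),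
-- hence S n x = ∑ⱼ c n j / (x - j) equals V n x for integers x > n, where x V n x = C(n+x,x) / C(x-1,n);
-- at a pole x = p ≤ n, dropping the singular term leaves the finite part c n p E n p with
-- E n p = H(n+p) + H(n-p) - 2 H(p).  Expanding 1 = (∑ᵢ c m i)(∑ⱼ c n j) with
-- 1 = i/(i-j) + j/(j-i) for i ≠ j gives ∑ᵢ i c m i S n i + ∑ⱼ j c n j S m j + ∑ⱼ c m j c n j;
-- the terms with index ≤ n form the first sum of the theorem, those with n < i ≤ m the second,
-- and multiplying by (-1)^(m+n) clears the signs.

module Submission where

open import Defs
open import Data.Nat using (ℕ; suc; _≤_)
open import Data.Rational using (ℚ; _+_)
open import Relation.Binary.PropositionalEquality using (_≡_)
open import Data.Nat as ℕ using (zero; _∸_; _<_; z≤n; s≤s)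
import Data.Nat.Properties as ℕP
open import Data.Nat.Combinatorics using (_C_; nCk+nC[k+1]≡[n+1]C[k+1]; nC1≡n; nCn≡1)
open import Data.Nat.Tactic.RingSolver using () renaming (solve-∀ to ℕ-solve-∀)
open import Data.Integer as ℤ using (+_)
import Data.Integer.Properties as ℤP
import Data.Nat.Coprimality as Coprime
open import Data.Rational using (mkℚ; 0ℚ; 1ℚ; _*_; -_; _-_; _/_; 1/_; ≢-nonZero)
open import Data.Rational.Properties
  using (_≟_; normalize-coprime; toℚᵘ-injective; toℚᵘ-homo-+; toℚᵘ-homo-*; +-*-commutativeRing;
         +-identityˡ; +-identityʳ; +-assoc; +-comm; +-inverseʳ;
         *-identityˡ; *-identityʳ; *-assoc; *-comm; *-zeroˡ; *-zeroʳ; *-distribˡ-+;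
         *-inverseˡ; *-inverseʳ; 1≢0)
import Data.Rational.Unnormalised as ℚᵘ
import Data.Rational.Unnormalised.Properties as ℚᵘP
open import Data.List using (map; applyUpTo; foldr)
open import Data.Maybe using (Maybe; just; nothing)
open import Data.Empty using (⊥-elim)
open import Data.Sum using (inj₁; inj₂)
open import Function using (_∘_)
open import Relation.Binary.PropositionalEquality using (refl; sym; trans; cong; cong₂; subst; module ≡-Reasoning)
open import Relation.Nullary using (yes; no; ¬_)
open import Tactic.RingSolver using (solve-∀)
open import Tactic.RingSolver.Core.AlmostCommutativeRing using (AlmostCommutativeRing; fromCommutativeRing)
open import Level using (0ℓ)

ring : AlmostCommutativeRing 0ℓ 0ℓ
ring = fromCommutativeRing +-*-commutativeRing isZero?
  where
  isZero? : (x : ℚ) → Maybe (0ℚ ≡ x)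
  isZero? x with x ≟ 0ℚ
  ... | yes x≡0 = just (sym x≡0)
  ... | no _    = nothing

-- An identity L ≡ R that follows from hypotheses lᵢ ≡ rᵢ is proved from a certificate
-- L - R ≡ Σᵢ qᵢ * (lᵢ - rᵢ), itself a ring identity checked by the solver.
infix  5 _⊙_
infixr 4 _⊕_

_⊙_ : ∀ q {l r : ℚ} → l ≡ r → q * (l - r) ≡ 0ℚ
_⊙_ q {l} refl = q*[l-l]≡0 q l
  where
  q*[l-l]≡0 : ∀ q l → q * (l - l) ≡ 0ℚ
  q*[l-l]≡0 = solve-∀ ring

_⊕_ : ∀ {x y} → x ≡ 0ℚ → y ≡ 0ℚ → x + y ≡ 0ℚ
refl ⊕ refl = refl

a-b≡0⇒a≡b : ∀ {a b} → a - b ≡ 0ℚ → a ≡ b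
a-b≡0⇒a≡b {a} {b} a-b≡0 = trans (a≡[a-b]+b a b) (trans (cong (_+ b) a-b≡0) (+-identityˡ b))
  where
  a≡[a-b]+b : ∀ a b → a ≡ (a - b) + b
  a≡[a-b]+b = solve-∀ ring

linear-combination : ∀ {L R D : ℚ} → L - R ≡ D → D ≡ 0ℚ → L ≡ R
linear-combination L-R≡D D≡0 = a-b≡0⇒a≡b (trans L-R≡D D≡0)

private
  fromℕ : ℕ → ℚ
  fromℕ n = mkℚ (+ n) 0 (Coprime.sym (Coprime.1-coprimeTo n))

  ⟦⟧-coprime : ∀ n → ⟦ n ⟧ ≡ fromℕ n
  ⟦⟧-coprime n = normalize-coprime (Coprime.sym (Coprime.1-coprimeTo n))

⟦⟧-homo-+ : ∀ a b → ⟦ a ℕ.+ b ⟧ ≡ ⟦ a ⟧ + ⟦ b ⟧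
⟦⟧-homo-+ a b rewrite ⟦⟧-coprime a | ⟦⟧-coprime b | ⟦⟧-coprime (a ℕ.+ b) =
  toℚᵘ-injective (ℚᵘP.≃-trans (ℚᵘ.*≡* (cong (ℤ._* + 1) numerators)) (ℚᵘP.≃-sym (toℚᵘ-homo-+ (fromℕ a) (fromℕ b))))
  where
  numerators : + (a ℕ.+ b) ≡ + a ℤ.* + 1 ℤ.+ + b ℤ.* + 1
  numerators = sym (cong₂ ℤ._+_ (ℤP.*-identityʳ (+ a)) (ℤP.*-identityʳ (+ b)))

⟦⟧-homo-* : ∀ a b → ⟦ a ℕ.* b ⟧ ≡ ⟦ a ⟧ * ⟦ b ⟧
⟦⟧-homo-* a b rewrite ⟦⟧-coprime a | ⟦⟧-coprime b | ⟦⟧-coprime (a ℕ.* b) =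
  toℚᵘ-injective (ℚᵘP.≃-trans (ℚᵘ.*≡* (cong (ℤ._* + 1) (ℤP.pos-* a b))) (ℚᵘP.≃-sym (toℚᵘ-homo-* (fromℕ a) (fromℕ b))))

⟦⟧-suc : ∀ n → ⟦ suc n ⟧ ≡ 1ℚ + ⟦ n ⟧
⟦⟧-suc = ⟦⟧-homo-+ 1

⟦⟧-injective : ∀ {a b} → ⟦ a ⟧ ≡ ⟦ b ⟧ → a ≡ b
⟦⟧-injective {a} {b} eq =
  ℤP.+-injective (cong ℚ.numerator (trans (sym (⟦⟧-coprime a)) (trans eq (⟦⟧-coprime b))))

⟦⟧-sub : ∀ {m p} → p ≤ m → ⟦ m ∸ p ⟧ ≡ ⟦ m ⟧ - ⟦ p ⟧
⟦⟧-sub {m} {p} p≤m = trans (a≡[a+b]-b ⟦ m ∸ p ⟧ ⟦ p ⟧)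
  (cong (_- ⟦ p ⟧) (trans (sym (⟦⟧-homo-+ (m ∸ p) p)) (cong ⟦_⟧ (ℕP.m∸n+n≡m p≤m))))
  where
  a≡[a+b]-b : ∀ a b → a ≡ (a + b) - b
  a≡[a+b]-b = solve-∀ ring

opaque
  inv : ℚ → ℚ
  inv q with q ≟ 0ℚ
  ... | yes _   = 0ℚ
  ... | no q≢0 = 1/_ q {{≢-nonZero q≢0}}

  inv-zero : inv 0ℚ ≡ 0ℚ
  inv-zero = refl

  inv-inverseʳ : ∀ q → ¬ q ≡ 0ℚ → q * inv q ≡ 1ℚ
  inv-inverseʳ q q≢0 with q ≟ 0ℚ
  ... | yes q≡0 = ⊥-elim (q≢0 q≡0)
  ... | no q≢0 = *-inverseʳ q {{≢-nonZero q≢0}}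

  inv-unique : ∀ a b → a * b ≡ 1ℚ → b ≡ inv a
  inv-unique a b ab≡1 with a ≟ 0ℚ
  ... | yes refl = ⊥-elim (1≢0 (trans (sym ab≡1) (*-zeroˡ b)))
  ... | no a≢0 = begin
    b              ≡⟨ sym (*-identityˡ b) ⟩
    1ℚ * b         ≡⟨ cong (_* b) (sym (*-inverseˡ a {{≢-nonZero a≢0}})) ⟩
    (a⁻¹ * a) * b  ≡⟨ *-assoc a⁻¹ a b ⟩
    a⁻¹ * (a * b)  ≡⟨ cong (a⁻¹ *_) ab≡1 ⟩
    a⁻¹ * 1ℚ       ≡⟨ *-identityʳ a⁻¹ ⟩
    a⁻¹            ∎
    where
    open ≡-Reasoning
    a⁻¹ : ℚ
    a⁻¹ = 1/_ a {{≢-nonZero a≢0}}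

1/[1+d]≡inv : ∀ d → + 1 / suc d ≡ inv ⟦ suc d ⟧
1/[1+d]≡inv d = inv-unique ⟦ suc d ⟧ (+ 1 / suc d) product
  where
  coprime : Coprime.Coprime 1 (suc d)
  coprime = Coprime.1-coprimeTo (suc d)
  product : ⟦ suc d ⟧ * (+ 1 / suc d) ≡ 1ℚ
  product rewrite normalize-coprime coprime | ⟦⟧-coprime (suc d) =
    toℚᵘ-injective (ℚᵘP.≃-trans (toℚᵘ-homo-* (fromℕ (suc d)) (mkℚ (+ 1) d coprime)) (ℚᵘ.*≡* cross))
    where
    cross : (+ suc d ℤ.* + 1) ℤ.* + 1 ≡ + 1 ℤ.* + (1 ℕ.* suc d)
    cross = trans (ℤP.*-identityʳ _) (trans (ℤP.*-identityʳ _)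
      (sym (trans (ℤP.*-identityˡ _) (cong +_ (ℕP.*-identityˡ (suc d))))))

÷ℕ≡*inv : ∀ q d → q ÷ℕ d ≡ q * inv ⟦ d ⟧
÷ℕ≡*inv q zero    = sym (trans (cong (q *_) inv-zero) (*-zeroʳ q))
÷ℕ≡*inv q (suc d) = cong (q *_) (1/[1+d]≡inv d)

inv-pos : ∀ n → ⟦ suc n ⟧ * inv ⟦ suc n ⟧ ≡ 1ℚ
inv-pos n = inv-inverseʳ _ (λ eq → ℕP.1+n≢0 (⟦⟧-injective {suc n} {0} eq))

inv-nonzero : ∀ {n} → ¬ n ≡ 0 → ⟦ n ⟧ * inv ⟦ n ⟧ ≡ 1ℚ
inv-nonzero {zero}  n≢0 = ⊥-elim (n≢0 refl)
inv-nonzero {suc n} _   = inv-pos n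

inv-sum : ∀ a b → (⟦ suc a ⟧ + ⟦ b ⟧) * inv (⟦ suc a ⟧ + ⟦ b ⟧) ≡ 1ℚ
inv-sum a b = subst (λ t → t * inv t ≡ 1ℚ) (⟦⟧-homo-+ (suc a) b) (inv-pos (a ℕ.+ b))

inv-diff : ∀ {a b} → ¬ a ≡ b → (⟦ a ⟧ - ⟦ b ⟧) * inv (⟦ a ⟧ - ⟦ b ⟧) ≡ 1ℚ
inv-diff {a} {b} a≢b = inv-inverseʳ _ (λ eq → a≢b (⟦⟧-injective (a-b≡0⇒a≡b eq)))

inv-diff-self : ∀ a → inv (⟦ a ⟧ - ⟦ a ⟧) ≡ 0ℚ
inv-diff-self a = trans (cong inv (+-inverseʳ ⟦ a ⟧)) inv-zero

H-suc : ∀ n → H (suc n) ≡ H n + inv ⟦ suc n ⟧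
H-suc n = cong (λ t → H n + t) (1/[1+d]≡inv n)

∑ : ℕ → (ℕ → ℚ) → ℚ
∑ zero    f = 0ℚ
∑ (suc n) f = f 0 + ∑ n (f ∘ suc)

syntax ∑ n (λ i → e) = ∑[ i < n ] e

∑-cong : ∀ {f g : ℕ → ℚ} n → (∀ i → i < n → f i ≡ g i) → ∑ n f ≡ ∑ n g
∑-cong zero    f≡g = refl
∑-cong (suc n) f≡g = cong₂ _+_ (f≡g 0 (s≤s z≤n)) (∑-cong n (λ i i<n → f≡g (suc i) (s≤s i<n)))

∑-zero : ∀ n → ∑[ _ < n ] 0ℚ ≡ 0ℚ
∑-zero zero    = refl
∑-zero (suc n) = trans (+-identityˡ _) (∑-zero n)

∑-+ : ∀ (f g : ℕ → ℚ) n → ∑[ i < n ] (f i + g i) ≡ ∑ n f + ∑ n g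
∑-+ f g zero    = refl
∑-+ f g (suc n) = trans (cong (λ t → f 0 + g 0 + t) (∑-+ (f ∘ suc) (g ∘ suc) n))
  (middle-four (f 0) (g 0) (∑ n (f ∘ suc)) (∑ n (g ∘ suc)))
  where
  middle-four : ∀ a b c d → a + b + (c + d) ≡ a + c + (b + d)
  middle-four = solve-∀ ring

∑-*ˡ : ∀ (q : ℚ) (f : ℕ → ℚ) n → ∑[ i < n ] (q * f i) ≡ q * ∑ n f
∑-*ˡ q f zero    = sym (*-zeroʳ q)
∑-*ˡ q f (suc n) = trans (cong (λ t → q * f 0 + t) (∑-*ˡ q (f ∘ suc) n)) (sym (*-distribˡ-+ q (f 0) _))

∑-*ʳ : ∀ (f : ℕ → ℚ) (q : ℚ) n → ∑ n f * q ≡ ∑[ i < n ] (f i * q)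
∑-*ʳ f q n = trans (*-comm (∑ n f) q) (trans (sym (∑-*ˡ q f n)) (∑-cong n (λ i _ → *-comm q (f i))))

∑-+₃ : ∀ (f g h : ℕ → ℚ) n → ∑[ j < n ] (f j + g j + h j) ≡ ∑ n f + ∑ n g + ∑ n h
∑-+₃ f g h n = trans (∑-+ (λ j → f j + g j) h n) (cong (_+ ∑ n h) (∑-+ f g n))

∑-linear₃ : ∀ (a b c : ℚ) (f g h : ℕ → ℚ) n →
  ∑[ j < n ] (a * f j + b * g j + c * h j) ≡ a * ∑ n f + b * ∑ n g + c * ∑ n h
∑-linear₃ a b c f g h n = trans (∑-+₃ (λ j → a * f j) (λ j → b * g j) (λ j → c * h j) n)
  (cong₂ _+_ (cong₂ _+_ (∑-*ˡ a f n) (∑-*ˡ b g n)) (∑-*ˡ c h n))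

∑-last : ∀ (f : ℕ → ℚ) n → ∑ (suc n) f ≡ ∑ n f + f n
∑-last f zero    = trans (+-identityʳ (f 0)) (sym (+-identityˡ (f 0)))
∑-last f (suc n) = trans (cong (λ t → f 0 + t) (∑-last (f ∘ suc) n)) (sym (+-assoc (f 0) _ _))

∑-split : ∀ (f : ℕ → ℚ) a b → ∑ (a ℕ.+ b) f ≡ ∑ a f + ∑[ i < b ] f (a ℕ.+ i)
∑-split f zero    b = sym (+-identityˡ _)
∑-split f (suc a) b = trans (cong (λ t → f 0 + t) (∑-split (f ∘ suc) a b)) (sym (+-assoc (f 0) _ _))

∑-comm : ∀ (f : ℕ → ℕ → ℚ) a b → ∑[ i < a ] ∑[ j < b ] f i j ≡ ∑[ j < b ] ∑[ i < a ] f i j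
∑-comm f zero    b = sym (∑-zero b)
∑-comm f (suc a) b = trans (cong (λ t → ∑ b (f 0) + t) (∑-comm (f ∘ suc) a b))
  (sym (∑-+ (f 0) (λ j → ∑[ i < a ] f (suc i) j) b))

sumFromTo≡∑ : ∀ a b f → sumFromTo a b f ≡ ∑[ i < suc b ∸ a ] f (a ℕ.+ i)
sumFromTo≡∑ a b f = foldr-applyUpTo (λ i → f (a ℕ.+ i)) (λ i → i) (suc b ∸ a)
  where
  foldr-applyUpTo : ∀ (g : ℕ → ℚ) (h : ℕ → ℕ) n → foldr _+_ 0ℚ (map g (applyUpTo h n)) ≡ ∑ n (g ∘ h)
  foldr-applyUpTo g h zero    = refl
  foldr-applyUpTo g h (suc n) = cong (λ t → g (h 0) + t) (foldr-applyUpTo g (h ∘ suc) n)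

δ : ℕ → ℕ → ℚ
δ zero    zero    = 1ℚ
δ zero    (suc _) = 0ℚ
δ (suc _) zero    = 0ℚ
δ (suc i) (suc j) = δ i j

δ-refl : ∀ i → δ i i ≡ 1ℚ
δ-refl zero    = refl
δ-refl (suc i) = δ-refl i

δ-≢ : ∀ {i j} → ¬ i ≡ j → δ i j ≡ 0ℚ
δ-≢ {zero}  {zero}  i≢j = ⊥-elim (i≢j refl)
δ-≢ {zero}  {suc j} i≢j = refl
δ-≢ {suc i} {zero}  i≢j = refl
δ-≢ {suc i} {suc j} i≢j = δ-≢ (i≢j ∘ cong suc)

∑-δ : ∀ (g : ℕ → ℚ) {n p} → p < n → ∑[ i < n ] (δ i p * g i) ≡ g p
∑-δ g {suc n} {zero} _ = begin
  1ℚ * g 0 + ∑[ i < n ] (0ℚ * g (suc i))  ≡⟨ cong₂ _+_ (*-identityˡ (g 0)) (∑-cong n (λ i _ → *-zeroˡ (g (suc i)))) ⟩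
  g 0 + ∑[ _ < n ] 0ℚ                      ≡⟨ cong (λ t → g 0 + t) (∑-zero n) ⟩
  g 0 + 0ℚ                                 ≡⟨ +-identityʳ (g 0) ⟩
  g 0                                      ∎
  where open ≡-Reasoning
∑-δ g {suc n} {suc p} (s≤s p<n) =
  trans (cong (_+ ∑[ i < n ] (δ i p * g (suc i))) (*-zeroˡ (g 0)))
        (trans (+-identityˡ _) (∑-δ (g ∘ suc) p<n))

∑-δ-out : ∀ (g : ℕ → ℚ) {n p} → n ≤ p → ∑[ i < n ] (δ i p * g i) ≡ 0ℚ
∑-δ-out g {zero}          _         = refl
∑-δ-out g {suc n} {suc p} (s≤s n≤p) =
  trans (cong (_+ ∑[ i < n ] (δ i p * g (suc i))) (*-zeroˡ (g 0)))
        (trans (+-identityˡ _) (∑-δ-out (g ∘ suc) n≤p))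

neg1^-+ : ∀ a b → neg1^ (a ℕ.+ b) ≡ neg1^ a * neg1^ b
neg1^-+ zero    b = sym (*-identityˡ _)
neg1^-+ (suc a) b = trans (cong -_ (neg1^-+ a b)) (-[xy]≡[-x]y (neg1^ a) (neg1^ b))
  where
  -[xy]≡[-x]y : ∀ x y → - (x * y) ≡ - x * y
  -[xy]≡[-x]y = solve-∀ ring

neg1^-square : ∀ a → neg1^ a * neg1^ a ≡ 1ℚ
neg1^-square zero    = refl
neg1^-square (suc a) = trans ([-x][-x]≡xx (neg1^ a)) (neg1^-square a)
  where
  [-x][-x]≡xx : ∀ x → - x * - x ≡ x * x
  [-x][-x]≡xx = solve-∀ ring

neg1^-parity : ∀ {a} b k → a ≡ b ℕ.+ (k ℕ.+ k) → neg1^ a ≡ neg1^ b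
neg1^-parity b k refl = begin
  neg1^ (b ℕ.+ (k ℕ.+ k))      ≡⟨ neg1^-+ b (k ℕ.+ k) ⟩
  neg1^ b * neg1^ (k ℕ.+ k)    ≡⟨ cong (neg1^ b *_) (trans (neg1^-+ k k) (neg1^-square k)) ⟩
  neg1^ b * 1ℚ                 ≡⟨ *-identityʳ (neg1^ b) ⟩
  neg1^ b                      ∎
  where open ≡-Reasoning

neg1^-cancel : ∀ a x → neg1^ a * (neg1^ a * x) ≡ x
neg1^-cancel a x = trans (x*[x*y]≡[x*x]*y (neg1^ a) x) (trans (cong (_* x) (neg1^-square a)) (*-identityˡ x))
  where
  x*[x*y]≡[x*x]*y : ∀ x y → x * (x * y) ≡ (x * x) * y
  x*[x*y]≡[x*x]*y = solve-∀ ring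

[k+1]*[n+1]C[k+1]≡[n+1]*nCk : ∀ a k → suc k ℕ.* (suc a C suc k) ≡ suc a ℕ.* (a C k)
[k+1]*[n+1]C[k+1]≡[n+1]*nCk zero    zero    = refl
[k+1]*[n+1]C[k+1]≡[n+1]*nCk zero    (suc k) = ℕP.*-zeroʳ (suc (suc k))
[k+1]*[n+1]C[k+1]≡[n+1]*nCk (suc a) zero    = trans (ℕP.*-identityˡ _) (trans (nC1≡n (suc (suc a))) (sym (ℕP.*-identityʳ _)))
[k+1]*[n+1]C[k+1]≡[n+1]*nCk (suc a) (suc k) = begin
  suc (suc k) ℕ.* (suc (suc a) C suc (suc k))  ≡⟨ cong (suc (suc k) ℕ.*_) (sym (pascal (suc a) (suc k))) ⟩
  suc (suc k) ℕ.* (X ℕ.+ Y)                    ≡⟨ split-factor k X Y ⟩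
  suc k ℕ.* X ℕ.+ X ℕ.+ suc (suc k) ℕ.* Y      ≡⟨ cong₂ (λ u v → u ℕ.+ X ℕ.+ v) ([k+1]*[n+1]C[k+1]≡[n+1]*nCk a k) ([k+1]*[n+1]C[k+1]≡[n+1]*nCk a (suc k)) ⟩
  suc a ℕ.* (a C k) ℕ.+ X ℕ.+ suc a ℕ.* (a C suc k)
                                               ≡⟨ collect (suc a) (a C k) X (a C suc k) ⟩
  suc a ℕ.* (a C k ℕ.+ a C suc k) ℕ.+ X        ≡⟨ cong (λ t → suc a ℕ.* t ℕ.+ X) (pascal a k) ⟩
  suc a ℕ.* X ℕ.+ X                            ≡⟨ ℕP.+-comm (suc a ℕ.* X) X ⟩
  suc (suc a) ℕ.* X                            ∎
  where
  open ≡-Reasoning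
  pascal : ∀ n k → n C k ℕ.+ n C suc k ≡ suc n C suc k
  pascal = nCk+nC[k+1]≡[n+1]C[k+1]
  X = suc a C suc k
  Y = suc a C suc (suc k)
  split-factor : ∀ k X Y → suc (suc k) ℕ.* (X ℕ.+ Y) ≡ suc k ℕ.* X ℕ.+ X ℕ.+ suc (suc k) ℕ.* Y
  split-factor = ℕ-solve-∀
  collect : ∀ A u X w → A ℕ.* u ℕ.+ X ℕ.+ A ℕ.* w ≡ A ℕ.* (u ℕ.+ w) ℕ.+ X
  collect = ℕ-solve-∀

k≤n⇒nCk≢0 : ∀ {a k} → k ≤ a → ¬ a C k ≡ 0
k≤n⇒nCk≢0 {a}     {zero}  _         ()
k≤n⇒nCk≢0 {suc a} {suc k} (s≤s k≤a) eq =
  k≤n⇒nCk≢0 k≤a (ℕP.m+n≡0⇒m≡0 (a C k) (trans (nCk+nC[k+1]≡[n+1]C[k+1] a k) eq))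

⟦C⟧-pascal : ∀ a k → ⟦ a C k ⟧ + ⟦ a C suc k ⟧ ≡ ⟦ suc a C suc k ⟧
⟦C⟧-pascal a k = trans (sym (⟦⟧-homo-+ (a C k) (a C suc k))) (cong ⟦_⟧ (nCk+nC[k+1]≡[n+1]C[k+1] a k))

⟦C⟧-absorb : ∀ a k → ⟦ suc k ⟧ * ⟦ suc a C suc k ⟧ ≡ ⟦ suc a ⟧ * ⟦ a C k ⟧
⟦C⟧-absorb a k = trans (sym (⟦⟧-homo-* (suc k) (suc a C suc k))) (trans (cong ⟦_⟧ ([k+1]*[n+1]C[k+1]≡[n+1]*nCk a k)) (⟦⟧-homo-* (suc a) (a C k)))

⟦C⟧-suc-k : ∀ a k → ⟦ suc k ⟧ * ⟦ a C suc k ⟧ ≡ (⟦ suc a ⟧ - ⟦ suc k ⟧) * ⟦ a C k ⟧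
⟦C⟧-suc-k a k = linear-combination (certificate ⟦ suc k ⟧ ⟦ suc a ⟧ ⟦ a C k ⟧ ⟦ a C suc k ⟧ ⟦ suc a C suc k ⟧)
  (⟦ suc k ⟧ ⊙ ⟦C⟧-pascal a k ⊕ 1ℚ ⊙ ⟦C⟧-absorb a k)
  where
  certificate : ∀ K A u w z → K * w - (A - K) * u ≡ K * ((u + w) - z) + 1ℚ * (K * z - A * u)
  certificate = solve-∀ ring

⟦C⟧-suc-n : ∀ a j → (⟦ suc a ⟧ - ⟦ j ⟧) * ⟦ suc a C j ⟧ ≡ ⟦ suc a ⟧ * ⟦ a C j ⟧
⟦C⟧-suc-n a zero    = [x-0]*1≡x*1 ⟦ suc a ⟧
  where
  [x-0]*1≡x*1 : ∀ x → (x - 0ℚ) * 1ℚ ≡ x * 1ℚ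
  [x-0]*1≡x*1 = solve-∀ ring
⟦C⟧-suc-n a (suc k) = linear-combination (certificate ⟦ suc k ⟧ ⟦ suc a ⟧ ⟦ a C k ⟧ ⟦ a C suc k ⟧ ⟦ suc a C suc k ⟧)
  ((- ⟦ suc a ⟧) ⊙ ⟦C⟧-pascal a k ⊕ (- 1ℚ) ⊙ ⟦C⟧-absorb a k)
  where
  certificate : ∀ K A u w z → (A - K) * z - A * w ≡ (- A) * ((u + w) - z) + (- 1ℚ) * (K * z - A * u)
  certificate = solve-∀ ring

-- The partial fraction decomposition of V

opaque
  c : ℕ → ℕ → ℚ
  c n j = neg1^ (n ∸ j) * (⟦ (n ℕ.+ j) C j ⟧ * ⟦ n C j ⟧)

  c-def : ∀ n j → c n j ≡ neg1^ (n ∸ j) * (⟦ (n ℕ.+ j) C j ⟧ * ⟦ n C j ⟧)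
  c-def n j = refl

  c-suc : ∀ {n j} → j ≤ n → c (suc n) j * (⟦ suc n ⟧ - ⟦ j ⟧) ≡ - ((⟦ suc n ⟧ + ⟦ j ⟧) * c n j)
  c-suc {n} {j} j≤n = trans (cong (λ t → neg1^ t * (Q * w) * (N - J)) (ℕP.+-∸-assoc 1 j≤n))
    (linear-combination (certificate s Q w P u N J)
      ((- s * Q) ⊙ ⟦C⟧-suc-n n j ⊕ (- s * u) ⊙ upper))
    where
    N J s Q w P u : ℚ
    N = ⟦ suc n ⟧
    J = ⟦ j ⟧
    s = neg1^ (n ∸ j)
    Q = ⟦ (suc n ℕ.+ j) C j ⟧
    w = ⟦ suc n C j ⟧
    P = ⟦ (n ℕ.+ j) C j ⟧
    u = ⟦ n C j ⟧
    upper : (N + J - J) * Q ≡ (N + J) * P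
    upper = subst (λ t → (t - J) * Q ≡ t * P) (⟦⟧-homo-+ (suc n) j) (⟦C⟧-suc-n (n ℕ.+ j) j)
    certificate : ∀ s Q w P u N J → (- s * (Q * w)) * (N - J) - (- ((N + J) * (s * (P * u)))) ≡
      (- s * Q) * ((N - J) * w - N * u) + (- s * u) * ((N + J - J) * Q - (N + J) * P)
    certificate = solve-∀ ring

S : ℕ → ℕ → ℚ
S n x = ∑[ j < suc n ] (c n j * inv (⟦ x ⟧ - ⟦ j ⟧))

V : ℕ → ℕ → ℚ
V zero    x = inv ⟦ x ⟧
V (suc n) x = V n x * (⟦ x ⟧ + ⟦ suc n ⟧) * inv (⟦ x ⟧ - ⟦ suc n ⟧)

V-binomial : ∀ {n x} → n < x → ⟦ x ⟧ * V n x * ⟦ (x ∸ 1) C n ⟧ ≡ ⟦ (n ℕ.+ x) C x ⟧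
V-binomial {zero} {suc x} _ =
  trans (x*y*1≡x*y ⟦ suc x ⟧ (inv ⟦ suc x ⟧)) (trans (inv-pos x) (sym (cong ⟦_⟧ (nCn≡1 (suc x)))))
  where
  x*y*1≡x*y : ∀ x y → x * y * 1ℚ ≡ x * y
  x*y*1≡x*y = solve-∀ ring
V-binomial {suc n} {suc x} (s≤s n<x) = linear-combination (certificate X N Vn CxN Cxn e Cnx CNx N⁻¹)
  ((N⁻¹ * X * Vn * (X + N) * e) ⊙ ⟦C⟧-suc-k x n
   ⊕ (N⁻¹ * (X + N)) ⊙ V-binomial (ℕP.m<n⇒m<1+n n<x)
   ⊕ (N⁻¹ * (X + N) * X * Vn * Cxn) ⊙ inv-diff (ℕP.<⇒≢ (s≤s n<x) ∘ sym)
   ⊕ (- N⁻¹) ⊙ upper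
   ⊕ (- (X * (Vn * (X + N) * e) * CxN - CNx)) ⊙ inv-pos n)
  where
  X = ⟦ suc x ⟧
  N = ⟦ suc n ⟧
  Vn = V n (suc x)
  CxN = ⟦ x C suc n ⟧
  Cxn = ⟦ x C n ⟧
  e = inv (X - N)
  Cnx = ⟦ (n ℕ.+ suc x) C suc x ⟧
  CNx = ⟦ (suc n ℕ.+ suc x) C suc x ⟧
  N⁻¹ = inv N
  upper : (N + X - X) * CNx ≡ (N + X) * Cnx
  upper = subst (λ t → (t - X) * CNx ≡ t * Cnx) (⟦⟧-homo-+ (suc n) (suc x)) (⟦C⟧-suc-n (n ℕ.+ suc x) (suc x))
  certificate : ∀ X N Vn CxN Cxn e Cnx CNx N⁻¹ → X * (Vn * (X + N) * e) * CxN - CNx ≡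
    (N⁻¹ * X * Vn * (X + N) * e) * (N * CxN - (X - N) * Cxn) + ((N⁻¹ * (X + N)) * (X * Vn * Cxn - Cnx) +
    ((N⁻¹ * (X + N) * X * Vn * Cxn) * ((X - N) * e - 1ℚ) + ((- N⁻¹) * ((N + X - X) * CNx - (N + X) * Cnx) +
    (- (X * (Vn * (X + N) * e) * CxN - CNx)) * (N * N⁻¹ - 1ℚ))))
  certificate = solve-∀ ring

c-diagonal : ∀ n → c (suc n) (suc n) ≡ (⟦ suc n ⟧ + ⟦ suc n ⟧) * V n (suc n)
c-diagonal n = trans (c-def (suc n) (suc n)) (linear-combination (certificate s N Vn D E CNN N⁻¹)
  ((- (N + N) * N⁻¹) ⊙ binomial ⊕ N⁻¹ ⊙ upper ⊕ (- (E - (N + N) * Vn)) ⊙ inv-pos n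
   ⊕ E ⊙ sign ⊕ (s * E) ⊙ cong ⟦_⟧ (nCn≡1 (suc n))))
  where
  s = neg1^ (suc n ∸ suc n)
  N = ⟦ suc n ⟧
  Vn = V n (suc n)
  D = ⟦ (n ℕ.+ suc n) C suc n ⟧
  E = ⟦ (suc n ℕ.+ suc n) C suc n ⟧
  CNN = ⟦ suc n C suc n ⟧
  N⁻¹ = inv N
  binomial : N * Vn * 1ℚ ≡ D
  binomial = trans (cong (N * Vn *_) (sym (cong ⟦_⟧ (nCn≡1 n)))) (V-binomial (ℕP.n<1+n n))
  upper : (N + N - N) * E ≡ (N + N) * D
  upper = subst (λ t → (t - N) * E ≡ t * D) (⟦⟧-homo-+ (suc n) (suc n)) (⟦C⟧-suc-n (n ℕ.+ suc n) (suc n))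
  sign : s ≡ 1ℚ
  sign = cong neg1^ (ℕP.n∸n≡0 (suc n))
  certificate : ∀ s N Vn D E CNN N⁻¹ → s * (E * CNN) - (N + N) * Vn ≡
    (- (N + N) * N⁻¹) * (N * Vn * 1ℚ - D) + (N⁻¹ * ((N + N - N) * E - (N + N) * D) +
    ((- (E - (N + N) * Vn)) * (N * N⁻¹ - 1ℚ) + (E * (s - 1ℚ) + (s * E) * (CNN - 1ℚ))))
  certificate = solve-∀ ring

-- Throughout, a = 1/(N - J), b = 1/(X - J), e = 1/(X - N), and cN, cn stand for
-- c (suc n) j, c n j with N = suc n, J = j.
module _ (N J a : ℚ) (Na : (N - J) * a ≡ 1ℚ) where

  c-step : ∀ cN cn → cN * (N - J) ≡ - ((N + J) * cn) → cN ≡ - ((N + J) * cn * a)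
  c-step cN cn hc = linear-combination (certificate cN cn N J a) ((- cN) ⊙ Na ⊕ a ⊙ hc)
    where
    certificate : ∀ cN cn N J a → cN - (- ((N + J) * cn * a)) ≡
      (- cN) * ((N - J) * a - 1ℚ) + a * (cN * (N - J) - - ((N + J) * cn))
    certificate = solve-∀ ring

  c-step-∑ : ∀ cN cn → cN * (N - J) ≡ - ((N + J) * cn) → cN ≡ cn + (- (N + N)) * (cn * a)
  c-step-∑ cN cn hc = linear-combination (certificate cN cn N J a) ((cn - cN) ⊙ Na ⊕ a ⊙ hc)
    where
    certificate : ∀ cN cn N J a → cN - (cn + (- (N + N)) * (cn * a)) ≡
      (cn - cN) * ((N - J) * a - 1ℚ) + a * (cN * (N - J) - - ((N + J) * cn))
    certificate = solve-∀ ring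

  c-step-diagonal : ∀ cN cn → cN * (N - J) ≡ - ((N + J) * cn) →
    cN * a ≡ (- (N + N)) * (cn * (a * a)) + cn * a
  c-step-diagonal cN cn hc = linear-combination (certificate cN cn N J a) ((cn * a - cN * a) ⊙ Na ⊕ (a * a) ⊙ hc)
    where
    certificate : ∀ cN cn N J a → cN * a - ((- (N + N)) * (cn * (a * a)) + cn * a) ≡
      (cn * a - cN * a) * ((N - J) * a - 1ℚ) + (a * a) * (cN * (N - J) - - ((N + J) * cn))
    certificate = solve-∀ ring

  module _ (X b e : ℚ) (Xb : (X - J) * b ≡ 1ℚ) (Xe : (X - N) * e ≡ 1ℚ) where

    partial-fractions : a * b ≡ e * (a - b)
    partial-fractions = linear-combination (certificate N J X a b e)
      ((- e * b) ⊙ Na ⊕ (e * a) ⊙ Xb ⊕ (- a * b) ⊙ Xe)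
      where
      certificate : ∀ N J X a b e → a * b - e * (a - b) ≡
        (- e * b) * ((N - J) * a - 1ℚ) + ((e * a) * ((X - J) * b - 1ℚ) + (- a * b) * ((X - N) * e - 1ℚ))
      certificate = solve-∀ ring

    c-step-S : ∀ cN cn → cN * (N - J) ≡ - ((N + J) * cn) →
      cN * b ≡ (- ((N + N) * e)) * (cn * a) + (N + X) * e * (cn * b)
    c-step-S cN cn hc = linear-combination (certificate cN cn N J X a b e)
      ((- cN * b + (N + X) * e * b * cn) ⊙ Na ⊕ (- (N + N) * e * a * cn) ⊙ Xb
       ⊕ (cn * (N + J) * a * b) ⊙ Xe ⊕ (a * b) ⊙ hc)
      where
      certificate : ∀ cN cn N J X a b e → cN * b - ((- ((N + N) * e)) * (cn * a) + (N + X) * e * (cn * b)) ≡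
        (- cN * b + (N + X) * e * b * cn) * ((N - J) * a - 1ℚ) + ((- (N + N) * e * a * cn) * ((X - J) * b - 1ℚ) +
        ((cn * (N + J) * a * b) * ((X - N) * e - 1ℚ) + (a * b) * (cN * (N - J) - - ((N + J) * cn))))
      certificate = solve-∀ ring

    c-step-S₂ : ∀ cN cn → cN * (N - J) ≡ - ((N + J) * cn) →
      cN * (b * b) ≡ (- ((N + N) * (e * e))) * (cn * a) + (N + N) * (e * e) * (cn * b) + (X + N) * e * (cn * (b * b))
    c-step-S₂ cN cn hc = linear-combination (certificate cN cn N J X a b e)
      (b ⊙ c-step-S cN cn hc ⊕ (- (N + N) * e * cn) ⊙ partial-fractions)
      where
      certificate : ∀ cN cn N J X a b e →
        cN * (b * b) - ((- ((N + N) * (e * e))) * (cn * a) + (N + N) * (e * e) * (cn * b) + (X + N) * e * (cn * (b * b))) ≡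
        b * (cN * b - ((- ((N + N) * e)) * (cn * a) + (N + X) * e * (cn * b))) + (- (N + N) * e * cn) * (a * b - e * (a - b))
      certificate = solve-∀ ring

inv-antisym : ∀ X Y {e a} → (X - Y) * e ≡ 1ℚ → (Y - X) * a ≡ 1ℚ → e ≡ - a
inv-antisym X Y {e} {a} Xe Ya = linear-combination (certificate X Y e a) ((- a) ⊙ Xe ⊕ (- e) ⊙ Ya)
  where
  certificate : ∀ X Y e a → e - (- a) ≡ (- a) * ((X - Y) * e - 1ℚ) + (- e) * ((Y - X) * a - 1ℚ)
  certificate = solve-∀ ring

≤⇒≢suc : ∀ {j n} → j ≤ n → ¬ j ≡ suc n
≤⇒≢suc j≤n = ℕP.<⇒≢ (s≤s j≤n)

S-suc-summand : ∀ {n x j} → ¬ x ≡ suc n → j ≤ n →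
  c (suc n) j * inv (⟦ x ⟧ - ⟦ j ⟧) ≡
    (- ((⟦ suc n ⟧ + ⟦ suc n ⟧) * inv (⟦ x ⟧ - ⟦ suc n ⟧))) * (c n j * inv (⟦ suc n ⟧ - ⟦ j ⟧))
    + (⟦ suc n ⟧ + ⟦ x ⟧) * inv (⟦ x ⟧ - ⟦ suc n ⟧) * (c n j * inv (⟦ x ⟧ - ⟦ j ⟧))
    + (⟦ suc n ⟧ + ⟦ suc n ⟧) * inv (⟦ x ⟧ - ⟦ suc n ⟧) * (δ j x * (c n j * inv (⟦ suc n ⟧ - ⟦ j ⟧)))
S-suc-summand {n} {x} {j} x≢N j≤n with j ℕ.≟ x
... | yes refl rewrite inv-diff-self j | δ-refl j =
  at-pole (c (suc n) j) (c n j) ((⟦ suc n ⟧ + ⟦ suc n ⟧) * inv (⟦ j ⟧ - ⟦ suc n ⟧))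
          ((⟦ suc n ⟧ + ⟦ j ⟧) * inv (⟦ j ⟧ - ⟦ suc n ⟧)) (inv (⟦ suc n ⟧ - ⟦ j ⟧))
  where
  at-pole : ∀ cN cn A B a → cN * 0ℚ ≡ (- A) * (cn * a) + B * (cn * 0ℚ) + A * (1ℚ * (cn * a))
  at-pole = solve-∀ ring
... | no j≢x rewrite δ-≢ j≢x =
  trans (c-step-S N ⟦ j ⟧ a (inv-diff (≤⇒≢suc j≤n ∘ sym)) X _ e (inv-diff (j≢x ∘ sym)) (inv-diff x≢N)
                  (c (suc n) j) (c n j) (c-suc j≤n))
        (drop-zero (- ((N + N) * e) * (c n j * a)) ((N + X) * e * (c n j * inv (X - ⟦ j ⟧))) ((N + N) * e) (c n j * a))
  where
  N = ⟦ suc n ⟧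
  X = ⟦ x ⟧
  e = inv (X - N)
  a = inv (N - ⟦ j ⟧)
  drop-zero : ∀ u v A g → u + v ≡ u + v + A * (0ℚ * g)
  drop-zero = solve-∀ ring

S-suc : ∀ {n x} → ¬ x ≡ suc n →
  S (suc n) x ≡
    (- ((⟦ suc n ⟧ + ⟦ suc n ⟧) * inv (⟦ x ⟧ - ⟦ suc n ⟧))) * S n (suc n)
    + (⟦ suc n ⟧ + ⟦ x ⟧) * inv (⟦ x ⟧ - ⟦ suc n ⟧) * S n x
    + (⟦ suc n ⟧ + ⟦ suc n ⟧) * inv (⟦ x ⟧ - ⟦ suc n ⟧) * ∑[ j < suc n ] (δ j x * (c n j * inv (⟦ suc n ⟧ - ⟦ j ⟧)))
    + c (suc n) (suc n) * inv (⟦ x ⟧ - ⟦ suc n ⟧)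
S-suc {n} {x} x≢N =
  trans (∑-last f (suc n))
        (cong (_+ f (suc n)) (trans (∑-cong (suc n) (λ j j<N → S-suc-summand x≢N (ℕP.≤-pred j<N)))
                                    (∑-linear₃ (- A) B A (λ j → c n j * inv (N - ⟦ j ⟧))
                                               (λ j → c n j * inv (X - ⟦ j ⟧))
                                               (λ j → δ j x * (c n j * inv (N - ⟦ j ⟧))) (suc n))))
  where
  N = ⟦ suc n ⟧
  X = ⟦ x ⟧
  A = (N + N) * inv (X - N)
  B = (N + X) * inv (X - N)
  f : ℕ → ℚ
  f j = c (suc n) j * inv (X - ⟦ j ⟧)

S≡V : ∀ {n x} → n < x → S n x ≡ V n x
S≡V {zero} {x} _ = trans (cong (λ t → t * inv (⟦ x ⟧ - 0ℚ) + 0ℚ) (c-def 0 0))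
  (trans (1*y+0≡y (inv (⟦ x ⟧ - 0ℚ))) (cong inv (x-0≡x ⟦ x ⟧)))
  where
  1*y+0≡y : ∀ y → 1ℚ * (1ℚ * 1ℚ) * y + 0ℚ ≡ y
  1*y+0≡y = solve-∀ ring
  x-0≡x : ∀ x → x - 0ℚ ≡ x
  x-0≡x = solve-∀ ring
S≡V {suc n} {x} N<x = trans (S-suc (ℕP.<⇒≢ N<x ∘ sym))
  (linear-combination (certificate N X e (S n (suc n)) (V n (suc n)) (S n x) (V n x) Sδ (c (suc n) (suc n)))
    ((- ((N + N) * e)) ⊙ S≡V (ℕP.n<1+n n) ⊕ ((N + X) * e) ⊙ S≡V (ℕP.<-trans (ℕP.n<1+n n) N<x)
     ⊕ ((N + N) * e) ⊙ ∑-δ-out (λ j → c n j * inv (N - ⟦ j ⟧)) (ℕP.<⇒≤ N<x) ⊕ e ⊙ c-diagonal n))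
  where
  N = ⟦ suc n ⟧
  X = ⟦ x ⟧
  e = inv (X - N)
  Sδ = ∑[ j < suc n ] (δ j x * (c n j * inv (N - ⟦ j ⟧)))
  certificate : ∀ N X e SnN VnN Snx Vnx Sδ cNN →
    (- ((N + N) * e)) * SnN + (N + X) * e * Snx + (N + N) * e * Sδ + cNN * e - Vnx * (X + N) * e ≡
    (- ((N + N) * e)) * (SnN - VnN) + ((N + X) * e * (Snx - Vnx) + ((N + N) * e * (Sδ - 0ℚ) + e * (cNN - (N + N) * VnN)))
  certificate = solve-∀ ring

∑c≡1 : ∀ n → ∑ (suc n) (c n) ≡ 1ℚ
∑c≡1 zero    = cong (_+ 0ℚ) (c-def 0 0)
∑c≡1 (suc n) = begin
  ∑ (suc (suc n)) (c (suc n))                             ≡⟨ ∑-last (c (suc n)) (suc n) ⟩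
  ∑ (suc n) (c (suc n)) + cNN                             ≡⟨ cong (_+ cNN) (∑-cong (suc n) expand) ⟩
  ∑[ j < suc n ] (c n j + (- (N + N)) * (c n j * inv (N - ⟦ j ⟧))) + cNN
                                                          ≡⟨ cong (_+ cNN) (∑-+ (c n) (λ j → (- (N + N)) * g j) (suc n)) ⟩
  ∑ (suc n) (c n) + ∑[ j < suc n ] ((- (N + N)) * (c n j * inv (N - ⟦ j ⟧))) + cNN
                                                          ≡⟨ cong (λ t → ∑ (suc n) (c n) + t + cNN) (∑-*ˡ (- (N + N)) g (suc n)) ⟩
  ∑ (suc n) (c n) + (- (N + N)) * S n (suc n) + cNN
      ≡⟨ linear-combination (certificate (∑ (suc n) (c n)) (S n (suc n)) (V n (suc n)) cNN N)
           (1ℚ ⊙ ∑c≡1 n ⊕ (- (N + N)) ⊙ S≡V (ℕP.n<1+n n) ⊕ 1ℚ ⊙ c-diagonal n) ⟩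
  1ℚ                                                      ∎
  where
  open ≡-Reasoning
  N = ⟦ suc n ⟧
  cNN = c (suc n) (suc n)
  g : ℕ → ℚ
  g j = c n j * inv (N - ⟦ j ⟧)
  expand : ∀ j → j < suc n → c (suc n) j ≡ c n j + (- (N + N)) * (c n j * inv (N - ⟦ j ⟧))
  expand j j<N = c-step-∑ N ⟦ j ⟧ _ (inv-diff (≤⇒≢suc (ℕP.≤-pred j<N) ∘ sym)) (c (suc n) j) (c n j) (c-suc (ℕP.≤-pred j<N))
  certificate : ∀ Σc SnN VnN cNN N → Σc + (- (N + N)) * SnN + cNN - 1ℚ ≡
    1ℚ * (Σc - 1ℚ) + ((- (N + N)) * (SnN - VnN) + 1ℚ * (cNN - (N + N) * VnN))
  certificate = solve-∀ ring

S₂ : ℕ → ℕ → ℚ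
S₂ n x = ∑[ j < suc n ] (c n j * (inv (⟦ x ⟧ - ⟦ j ⟧) * inv (⟦ x ⟧ - ⟦ j ⟧)))

-- L n x = - V′(x) / V(x), so that S₂ = - S′ = V * L away from the poles.
L : ℕ → ℕ → ℚ
L n x = ∑[ j < suc n ] inv (⟦ x ⟧ - ⟦ j ⟧) - ∑[ i < n ] inv (⟦ x ⟧ + ⟦ suc i ⟧)

S₂-suc : ∀ {n x} → suc n < x →
  S₂ (suc n) x ≡ (- ((⟦ suc n ⟧ + ⟦ suc n ⟧) * (inv (⟦ x ⟧ - ⟦ suc n ⟧) * inv (⟦ x ⟧ - ⟦ suc n ⟧)))) * S n (suc n)
    + (⟦ suc n ⟧ + ⟦ suc n ⟧) * (inv (⟦ x ⟧ - ⟦ suc n ⟧) * inv (⟦ x ⟧ - ⟦ suc n ⟧)) * S n x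
    + (⟦ x ⟧ + ⟦ suc n ⟧) * inv (⟦ x ⟧ - ⟦ suc n ⟧) * S₂ n x
    + c (suc n) (suc n) * (inv (⟦ x ⟧ - ⟦ suc n ⟧) * inv (⟦ x ⟧ - ⟦ suc n ⟧))
S₂-suc {n} {x} N<x =
  trans (∑-last f (suc n))
        (cong (_+ f (suc n)) (trans (∑-cong (suc n) summand)
                                    (∑-linear₃ (- A) A B (λ j → c n j * inv (N - ⟦ j ⟧))
                                               (λ j → c n j * inv (X - ⟦ j ⟧))
                                               (λ j → c n j * (inv (X - ⟦ j ⟧) * inv (X - ⟦ j ⟧))) (suc n))))
  where
  N = ⟦ suc n ⟧
  X = ⟦ x ⟧
  e = inv (X - N)
  A = (N + N) * (e * e)
  B = (X + N) * e
  f : ℕ → ℚ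
  f j = c (suc n) j * (inv (X - ⟦ j ⟧) * inv (X - ⟦ j ⟧))
  summand : ∀ j → j < suc n → f j ≡ (- A) * (c n j * inv (N - ⟦ j ⟧)) + A * (c n j * inv (X - ⟦ j ⟧))
                                      + B * (c n j * (inv (X - ⟦ j ⟧) * inv (X - ⟦ j ⟧)))
  summand j j<N = c-step-S₂ N ⟦ j ⟧ _ (inv-diff (≤⇒≢suc j≤n ∘ sym)) X _ e
    (inv-diff (ℕP.<⇒≢ (ℕP.<-trans j<N N<x) ∘ sym)) (inv-diff (ℕP.<⇒≢ N<x ∘ sym))
    (c (suc n) j) (c n j) (c-suc j≤n)
    where
    j≤n = ℕP.≤-pred j<N

L-suc : ∀ n x → L (suc n) x ≡ L n x + inv (⟦ x ⟧ - ⟦ suc n ⟧) - inv (⟦ x ⟧ + ⟦ suc n ⟧)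
L-suc n x = trans (cong₂ _-_ (∑-last g (suc n)) (∑-last h n)) (rearrange (∑ (suc n) g) (g (suc n)) (∑ n h) (h n))
  where
  g h : ℕ → ℚ
  g j = inv (⟦ x ⟧ - ⟦ j ⟧)
  h i = inv (⟦ x ⟧ + ⟦ suc i ⟧)
  rearrange : ∀ a b c d → (a + b) - (c + d) ≡ (a - c) + b - d
  rearrange = solve-∀ ring

S₂≡V*L : ∀ {n x} → n < x → S₂ n x ≡ V n x * L n x
S₂≡V*L {zero} {x} _ = trans (cong (λ t → t * (inv (⟦ x ⟧ - 0ℚ) * inv (⟦ x ⟧ - 0ℚ)) + 0ℚ) (c-def 0 0))
  (trans (cong (λ t → 1ℚ * (1ℚ * 1ℚ) * (t * t) + 0ℚ) (cong inv (x-0≡x ⟦ x ⟧)))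
   (trans (base (inv ⟦ x ⟧)) (cong (λ t → inv ⟦ x ⟧ * (t + 0ℚ - 0ℚ)) (cong inv (sym (x-0≡x ⟦ x ⟧))))))
  where
  base : ∀ a → 1ℚ * (1ℚ * 1ℚ) * (a * a) + 0ℚ ≡ a * (a + 0ℚ - 0ℚ)
  base = solve-∀ ring
  x-0≡x : ∀ a → a - 0ℚ ≡ a
  x-0≡x = solve-∀ ring
S₂≡V*L {suc n} {x} N<x = trans (S₂-suc N<x) (linear-combination
  (certificate N X e f (S n (suc n)) (S n x) (S₂ n x) (c (suc n) (suc n)) (V n (suc n)) Vnx (L n x) (L (suc n) x))
  ((- (+ 2 / 1 * N * e * e)) ⊙ S≡V (ℕP.n<1+n n) ⊕ (+ 2 / 1 * N * e * e) ⊙ S≡V n<x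
   ⊕ (N * e + X * e) ⊙ S₂≡V*L n<x ⊕ (e * e) ⊙ c-diagonal n
   ⊕ (- (N * Vnx * e) - Vnx * X * e) ⊙ L-suc n x ⊕ (- (Vnx * e)) ⊙ inv-diff (ℕP.<⇒≢ N<x ∘ sym)
   ⊕ (Vnx * e) ⊙ subst (λ t → t * inv t ≡ 1ℚ) (+-comm ⟦ suc n ⟧ X) (inv-sum n x)))
  where
  n<x = ℕP.<-trans (ℕP.n<1+n n) N<x
  N = ⟦ suc n ⟧
  X = ⟦ x ⟧
  e = inv (X - N)
  f = inv (X + N)
  Vnx = V n x
  certificate : ∀ N X e f SnN Snx S₂nx cNN VnN Vnx Lnx LNx →
    ((- ((N + N) * (e * e))) * SnN + (N + N) * (e * e) * Snx + (X + N) * e * S₂nx + cNN * (e * e)) - (Vnx * (X + N) * e * LNx) ≡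
    (- (+ 2 / 1 * N * e * e)) * (SnN - VnN) + ((+ 2 / 1 * N * e * e) * (Snx - Vnx) + ((N * e + X * e) * (S₂nx - Vnx * Lnx)
    + ((e * e) * (cNN - (N + N) * VnN) + ((- (N * Vnx * e) - Vnx * X * e) * (LNx - (Lnx + e - f))
    + ((- (Vnx * e)) * ((X - N) * e - 1ℚ) + (Vnx * e) * ((X + N) * f - 1ℚ))))))
  certificate = solve-∀ ring

-- The finite part at a pole

E : ℕ → ℕ → ℚ
E n p = H (n ℕ.+ p) + H (n ∸ p) - (H p + H p)

∑-inv-diff≡H : ∀ k → ∑[ j < k ] inv (⟦ k ⟧ - ⟦ j ⟧) ≡ H k
∑-inv-diff≡H zero    = refl
∑-inv-diff≡H (suc k) = begin
  inv (⟦ suc k ⟧ - 0ℚ) + ∑[ j < k ] inv (⟦ suc k ⟧ - ⟦ suc j ⟧)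
    ≡⟨ cong₂ _+_ (cong inv (x-0≡x ⟦ suc k ⟧)) (∑-cong k (λ j _ → cong inv (shift k j))) ⟩
  inv ⟦ suc k ⟧ + ∑[ j < k ] inv (⟦ k ⟧ - ⟦ j ⟧)  ≡⟨ cong (λ t → inv ⟦ suc k ⟧ + t) (∑-inv-diff≡H k) ⟩
  inv ⟦ suc k ⟧ + H k                              ≡⟨ +-comm (inv ⟦ suc k ⟧) (H k) ⟩
  H k + inv ⟦ suc k ⟧                              ≡⟨ sym (H-suc k) ⟩
  H (suc k)                                        ∎
  where
  open ≡-Reasoning
  x-0≡x : ∀ a → a - 0ℚ ≡ a
  x-0≡x = solve-∀ ring
  shift : ∀ k j → ⟦ suc k ⟧ - ⟦ suc j ⟧ ≡ ⟦ k ⟧ - ⟦ j ⟧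
  shift k j rewrite ⟦⟧-suc k | ⟦⟧-suc j = [1+a]-[1+b]≡a-b ⟦ k ⟧ ⟦ j ⟧
    where
    [1+a]-[1+b]≡a-b : ∀ a b → 1ℚ + a - (1ℚ + b) ≡ a - b
    [1+a]-[1+b]≡a-b = solve-∀ ring

H-+ : ∀ a b → H (a ℕ.+ b) ≡ H a + ∑[ i < b ] inv (⟦ a ⟧ + ⟦ suc i ⟧)
H-+ a zero    = trans (cong H (ℕP.+-identityʳ a)) (sym (+-identityʳ (H a)))
H-+ a (suc b) = begin
  H (a ℕ.+ suc b)                    ≡⟨ cong H (ℕP.+-suc a b) ⟩
  H (suc (a ℕ.+ b))                  ≡⟨ H-suc (a ℕ.+ b) ⟩
  H (a ℕ.+ b) + inv ⟦ suc (a ℕ.+ b) ⟧ ≡⟨ cong₂ _+_ (H-+ a b) (cong inv a+[1+b]) ⟩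
  H a + ∑ b g + g b                  ≡⟨ +-assoc (H a) (∑ b g) (g b) ⟩
  H a + (∑ b g + g b)                ≡⟨ cong (λ t → H a + t) (sym (∑-last g b)) ⟩
  H a + ∑ (suc b) g                  ∎
  where
  open ≡-Reasoning
  g : ℕ → ℚ
  g i = inv (⟦ a ⟧ + ⟦ suc i ⟧)
  a+[1+b] : ⟦ suc (a ℕ.+ b) ⟧ ≡ ⟦ a ⟧ + ⟦ suc b ⟧
  a+[1+b] = trans (cong ⟦_⟧ (sym (ℕP.+-suc a b))) (⟦⟧-homo-+ a (suc b))

E-suc : ∀ {n p} → p ≤ n → E (suc n) p ≡ E n p + inv (⟦ suc n ⟧ + ⟦ p ⟧) + inv (⟦ suc n ⟧ - ⟦ p ⟧)
E-suc {n} {p} p≤n = begin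
  H (suc (n ℕ.+ p)) + H (suc n ∸ p) - (H p + H p)
    ≡⟨ cong₂ (λ u v → u + v - (H p + H p))
         (trans (H-suc (n ℕ.+ p)) (cong (λ t → H (n ℕ.+ p) + inv t) (⟦⟧-homo-+ (suc n) p)))
         (trans (cong H (ℕP.+-∸-assoc 1 p≤n))
                (trans (H-suc (n ∸ p)) (cong (λ t → H (n ∸ p) + inv t) suc[n-p]))) ⟩
  H (n ℕ.+ p) + f + (H (n ∸ p) + a) - (H p + H p) ≡⟨ rearrange (H (n ℕ.+ p)) (H (n ∸ p)) (H p) f a ⟩
  E n p + f + a                                    ∎
  where
  open ≡-Reasoning
  f = inv (⟦ suc n ⟧ + ⟦ p ⟧)
  a = inv (⟦ suc n ⟧ - ⟦ p ⟧)
  suc[n-p] : ⟦ suc (n ∸ p) ⟧ ≡ ⟦ suc n ⟧ - ⟦ p ⟧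
  suc[n-p] = trans (cong ⟦_⟧ (sym (ℕP.+-∸-assoc 1 p≤n))) (⟦⟧-sub (ℕP.m≤n⇒m≤1+n p≤n))
  rearrange : ∀ x y h f a → x + f + (y + a) - (h + h) ≡ x + y - (h + h) + f + a
  rearrange = solve-∀ ring

S-diagonal-expand : ∀ n → S (suc n) (suc n) ≡ (- (⟦ suc n ⟧ + ⟦ suc n ⟧)) * S₂ n (suc n) + S n (suc n)
S-diagonal-expand n = begin
  S (suc n) (suc n)                                     ≡⟨ ∑-last f (suc n) ⟩
  ∑ (suc n) f + f (suc n)                               ≡⟨ cong₂ _+_ (∑-cong (suc n) summand) at-pole ⟩
  ∑[ j < suc n ] ((- (N + N)) * g₂ j + g j) + 0ℚ         ≡⟨ +-identityʳ _ ⟩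
  ∑[ j < suc n ] ((- (N + N)) * g₂ j + g j)             ≡⟨ ∑-+ (λ j → (- (N + N)) * g₂ j) g (suc n) ⟩
  ∑[ j < suc n ] ((- (N + N)) * g₂ j) + S n (suc n)     ≡⟨ cong (_+ S n (suc n)) (∑-*ˡ (- (N + N)) g₂ (suc n)) ⟩
  (- (N + N)) * S₂ n (suc n) + S n (suc n)              ∎
  where
  open ≡-Reasoning
  N = ⟦ suc n ⟧
  f g g₂ : ℕ → ℚ
  f j = c (suc n) j * inv (N - ⟦ j ⟧)
  g j = c n j * inv (N - ⟦ j ⟧)
  g₂ j = c n j * (inv (N - ⟦ j ⟧) * inv (N - ⟦ j ⟧))
  summand : ∀ j → j < suc n → f j ≡ (- (N + N)) * g₂ j + g j
  summand j j<N = c-step-diagonal N ⟦ j ⟧ _ (inv-diff (≤⇒≢suc (ℕP.≤-pred j<N) ∘ sym))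
                    (c (suc n) j) (c n j) (c-suc (ℕP.≤-pred j<N))
  at-pole : f (suc n) ≡ 0ℚ
  at-pole = trans (cong (c (suc n) (suc n) *_) (inv-diff-self (suc n))) (*-zeroʳ (c (suc n) (suc n)))

L-diagonal : ∀ n → L n (suc n) ≡ H (suc n) - (H (suc n ℕ.+ n) - H (suc n))
L-diagonal n = cong₂ _-_ (∑-inv-diff≡H (suc n))
  (trans (s≡h+s-h (∑[ i < n ] inv (⟦ suc n ⟧ + ⟦ suc i ⟧)) (H (suc n))) (cong (_- H (suc n)) (sym (H-+ (suc n) n))))
  where
  s≡h+s-h : ∀ s h → s ≡ h + s - h
  s≡h+s-h = solve-∀ ring

S-diagonal : ∀ n → S (suc n) (suc n) ≡ c (suc n) (suc n) * E (suc n) (suc n)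
S-diagonal n = trans (S-diagonal-expand n)
  (linear-combination (certificate N g (S₂ n (suc n)) (S n (suc n)) cNN VnN (L n (suc n)) HN HNn HNN (E (suc n) (suc n)))
    ((- (+ 2 / 1 * N)) ⊙ S₂≡V*L (ℕP.n<1+n n) ⊕ 1ℚ ⊙ S≡V (ℕP.n<1+n n) ⊕ (- (+ 2 / 1 * N * VnN)) ⊙ L-diagonal n
     ⊕ (- cNN) ⊙ E-diagonal ⊕ (- cNN) ⊙ H-double ⊕ (+ 2 / 1 * HN - HNn - g) ⊙ c-diagonal n
     ⊕ (- VnN) ⊙ inv-sum n (suc n)))
  where
  N = ⟦ suc n ⟧
  g = inv (N + N)
  cNN = c (suc n) (suc n)
  VnN = V n (suc n)
  HN = H (suc n)
  HNn = H (suc n ℕ.+ n)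
  HNN = H (suc n ℕ.+ suc n)
  E-diagonal : E (suc n) (suc n) ≡ HNN + 0ℚ - (HN + HN)
  E-diagonal = cong (λ t → HNN + H t - (HN + HN)) (ℕP.n∸n≡0 (suc n))
  H-double : HNN ≡ HNn + g
  H-double = trans (cong H (ℕP.+-suc (suc n) n)) (trans (H-suc (suc n ℕ.+ n))
    (cong (λ t → HNn + inv t) (trans (cong ⟦_⟧ (sym (ℕP.+-suc (suc n) n))) (⟦⟧-homo-+ (suc n) (suc n)))))
  certificate : ∀ N g S₂nN SnN cNN VnN LnN HN HNn HNN ENN → ((- (N + N)) * S₂nN + SnN) - (cNN * ENN) ≡
    (- (+ 2 / 1 * N)) * (S₂nN - VnN * LnN) + (1ℚ * (SnN - VnN) + ((- (+ 2 / 1 * N * VnN)) * (LnN - (HN - (HNn - HN)))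
    + ((- cNN) * (ENN - (HNN + 0ℚ - (HN + HN))) + ((- cNN) * (HNN - (HNn + g))
    + ((+ 2 / 1 * HN - HNn - g) * (cNN - (N + N) * VnN) + (- VnN) * ((N + N) * g - 1ℚ))))))
  certificate = solve-∀ ring

-- The j = p summand of S n p is c n p * inv 0 = 0.
S-at-pole : ∀ {n p} → p ≤ n → S n p ≡ c n p * E n p
S-at-pole {zero} {zero} z≤n = trans (cong (λ t → c 0 0 * t + 0ℚ) (inv-diff-self 0)) (base (c 0 0))
  where
  base : ∀ a → a * 0ℚ + 0ℚ ≡ a * (0ℚ + 0ℚ - (0ℚ + 0ℚ))
  base = solve-∀ ring
S-at-pole {suc m} {p} p≤N with ℕP.m≤n⇒m<n∨m≡n p≤N
... | inj₂ refl = S-diagonal m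
... | inj₁ p<N = trans (S-suc p≢N) (linear-combination
  (certificate N P e a f cNp cmp Emp VmN (S m (suc m)) (S m p) Sδ cNN (E (suc m) p))
  ((- (+ 2 / 1 * N * e)) ⊙ S≡V (ℕP.n<1+n m) ⊕ (N * e + P * e) ⊙ S-at-pole p≤m
   ⊕ (+ 2 / 1 * N * e) ⊙ ∑-δ (λ j → c m j * inv (N - ⟦ j ⟧)) p<N ⊕ e ⊙ c-diagonal m
   ⊕ (- cNp) ⊙ E-suc p≤m ⊕ (- Emp - a - f) ⊙ c-step N P a Na cNp cmp (c-suc p≤m)
   ⊕ (Emp * N * cmp + Emp * P * cmp + + 2 / 1 * N * a * cmp) ⊙ inv-antisym P N (inv-diff p≢N) Na
   ⊕ (- (a * cmp)) ⊙ Na ⊕ (a * cmp) ⊙ inv-sum m p))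
  where
  p≤m = ℕP.≤-pred p<N
  p≢N = ≤⇒≢suc p≤m
  N = ⟦ suc m ⟧
  P = ⟦ p ⟧
  e = inv (P - N)
  a = inv (N - P)
  f = inv (N + P)
  Na : (N - P) * a ≡ 1ℚ
  Na = inv-diff (p≢N ∘ sym)
  cNp = c (suc m) p
  cmp = c m p
  Emp = E m p
  VmN = V m (suc m)
  Sδ = ∑[ j < suc m ] (δ j p * (c m j * inv (N - ⟦ j ⟧)))
  cNN = c (suc m) (suc m)
  certificate : ∀ N P e a f cNp cmp Emp VmN SmN Smp Sδ cNN ENp →
    ((- ((N + N) * e)) * SmN + (N + P) * e * Smp + (N + N) * e * Sδ + cNN * e) - (cNp * ENp) ≡
    (- (+ 2 / 1 * N * e)) * (SmN - VmN) + ((N * e + P * e) * (Smp - cmp * Emp) + ((+ 2 / 1 * N * e) * (Sδ - cmp * a)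
    + (e * (cNN - (N + N) * VmN) + ((- cNp) * (ENp - (Emp + f + a)) + ((- Emp - a - f) * (cNp - (- ((N + P) * cmp * a)))
    + ((Emp * N * cmp + Emp * P * cmp + + 2 / 1 * N * a * cmp) * (e - (- a))
    + ((- (a * cmp)) * ((N - P) * a - 1ℚ) + (a * cmp) * ((N + P) * f - 1ℚ))))))))
  certificate = solve-∀ ring

-- Expanding (∑ᵢ c m i) (∑ⱼ c n j) = 1

c*c≡±C : ∀ {m n p} → p ≤ n → n ≤ m →
  c m p * c n p ≡ neg1^ (m ℕ.+ n) * ⟦ ((m ℕ.+ p) C p) ℕ.* (m C p) ℕ.* ((n ℕ.+ p) C p) ℕ.* (n C p) ⟧
c*c≡±C {m} {n} {p} p≤n n≤m = begin
  c m p * c n p                                ≡⟨ cong₂ _*_ (c-def m p) (c-def n p) ⟩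
  neg1^ (m ∸ p) * (A₁ * A₂) * (neg1^ (n ∸ p) * (A₃ * A₄))
                                               ≡⟨ rearrange (neg1^ (m ∸ p)) (neg1^ (n ∸ p)) A₁ A₂ A₃ A₄ ⟩
  neg1^ (m ∸ p) * neg1^ (n ∸ p) * (A₁ * A₂ * A₃ * A₄)
                                               ≡⟨ cong₂ _*_ (sym (trans (neg1^-parity (m ∸ p ℕ.+ (n ∸ p)) p parity) (neg1^-+ (m ∸ p) (n ∸ p))))
                                                            (sym product) ⟩
  neg1^ (m ℕ.+ n) * ⟦ ((m ℕ.+ p) C p) ℕ.* (m C p) ℕ.* ((n ℕ.+ p) C p) ℕ.* (n C p) ⟧ ∎
  where
  open ≡-Reasoning
  A₁ = ⟦ (m ℕ.+ p) C p ⟧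
  A₂ = ⟦ m C p ⟧
  A₃ = ⟦ (n ℕ.+ p) C p ⟧
  A₄ = ⟦ n C p ⟧
  rearrange : ∀ s t a b c d → s * (a * b) * (t * (c * d)) ≡ s * t * (a * b * c * d)
  rearrange = solve-∀ ring
  product : ⟦ ((m ℕ.+ p) C p) ℕ.* (m C p) ℕ.* ((n ℕ.+ p) C p) ℕ.* (n C p) ⟧ ≡ A₁ * A₂ * A₃ * A₄
  product = trans (⟦⟧-homo-* (((m ℕ.+ p) C p) ℕ.* (m C p) ℕ.* ((n ℕ.+ p) C p)) (n C p))
    (cong (_* A₄) (trans (⟦⟧-homo-* (((m ℕ.+ p) C p) ℕ.* (m C p)) ((n ℕ.+ p) C p))
                        (cong (_* A₃) (⟦⟧-homo-* ((m ℕ.+ p) C p) (m C p)))))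
  parity : m ℕ.+ n ≡ (m ∸ p) ℕ.+ (n ∸ p) ℕ.+ (p ℕ.+ p)
  parity = trans (cong₂ ℕ._+_ (sym (ℕP.m∸n+n≡m (ℕP.≤-trans p≤n n≤m))) (sym (ℕP.m∸n+n≡m p≤n)))
                 (regroup (m ∸ p) (n ∸ p) p)
    where
    regroup : ∀ a b p → (a ℕ.+ p) ℕ.+ (b ℕ.+ p) ≡ a ℕ.+ b ℕ.+ (p ℕ.+ p)
    regroup = ℕ-solve-∀

split-unit : ∀ i j → ⟦ i ⟧ * inv (⟦ i ⟧ - ⟦ j ⟧) + ⟦ j ⟧ * inv (⟦ j ⟧ - ⟦ i ⟧) + δ i j ≡ 1ℚ
split-unit i j with i ℕ.≟ j
... | yes refl rewrite inv-diff-self i | δ-refl i = i≡j ⟦ i ⟧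
  where
  i≡j : ∀ a → a * 0ℚ + a * 0ℚ + 1ℚ ≡ 1ℚ
  i≡j = solve-∀ ring
... | no i≢j rewrite δ-≢ i≢j = linear-combination (certificate ⟦ i ⟧ ⟦ j ⟧ a a′)
  ((1ℚ - ⟦ j ⟧ * a′) ⊙ inv-diff i≢j ⊕ (- ⟦ j ⟧ * a) ⊙ inv-diff (i≢j ∘ sym))
  where
  a = inv (⟦ i ⟧ - ⟦ j ⟧)
  a′ = inv (⟦ j ⟧ - ⟦ i ⟧)
  certificate : ∀ I J a a′ → I * a + J * a′ + 0ℚ - 1ℚ ≡
    (1ℚ - J * a′) * ((I - J) * a - 1ℚ) + (- J * a) * ((J - I) * a′ - 1ℚ)
  certificate = solve-∀ ring

∑c*∑c-expand : ∀ {m n} → n ≤ m →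
  1ℚ ≡ ∑[ i < suc m ] (c m i * ⟦ i ⟧ * S n i) + ∑[ j < suc n ] (c n j * ⟦ j ⟧ * S m j) + ∑[ j < suc n ] (c m j * c n j)
∑c*∑c-expand {m} {n} n≤m = begin
  1ℚ                                             ≡⟨ sym (cong₂ _*_ (∑c≡1 m) (∑c≡1 n)) ⟩
  ∑ M (c m) * ∑ N (c n)                          ≡⟨ ∑-*ʳ (c m) (∑ N (c n)) M ⟩
  ∑[ i < M ] (c m i * ∑ N (c n))                 ≡⟨ ∑-cong M (λ i _ → sym (∑-*ˡ (c m i) (c n) N)) ⟩
  ∑[ i < M ] ∑[ j < N ] (c m i * c n j)          ≡⟨ ∑-cong M (λ i _ → ∑-cong N (λ j _ → split i j)) ⟩
  ∑[ i < M ] ∑[ j < N ] (X₁ i j + X₂ i j + X₃ i j)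
      ≡⟨ ∑-cong M (λ i _ → ∑-+₃ (X₁ i) (X₂ i) (X₃ i) N) ⟩
  ∑[ i < M ] (∑ N (X₁ i) + ∑ N (X₂ i) + ∑ N (X₃ i))
      ≡⟨ ∑-+₃ (λ i → ∑ N (X₁ i)) (λ i → ∑ N (X₂ i)) (λ i → ∑ N (X₃ i)) M ⟩
  ∑[ i < M ] ∑ N (X₁ i) + ∑[ i < M ] ∑ N (X₂ i) + ∑[ i < M ] ∑ N (X₃ i)
      ≡⟨ cong₂ _+_ (cong₂ _+_ first second) third ⟩
  ∑[ i < M ] (c m i * ⟦ i ⟧ * S n i) + ∑[ j < N ] (c n j * ⟦ j ⟧ * S m j) + ∑[ j < N ] (c m j * c n j) ∎
  where
  open ≡-Reasoning
  M = suc m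
  N = suc n
  X₁ X₂ X₃ : ℕ → ℕ → ℚ
  X₁ i j = c m i * ⟦ i ⟧ * (c n j * inv (⟦ i ⟧ - ⟦ j ⟧))
  X₂ i j = c n j * ⟦ j ⟧ * (c m i * inv (⟦ j ⟧ - ⟦ i ⟧))
  X₃ i j = δ i j * (c m i * c n j)
  split : ∀ i j → c m i * c n j ≡ X₁ i j + X₂ i j + X₃ i j
  split i j = trans (sym (*-identityʳ (c m i * c n j)))
    (trans (cong (c m i * c n j *_) (sym (split-unit i j)))
           (distribute (c m i) (c n j) ⟦ i ⟧ ⟦ j ⟧ (inv (⟦ i ⟧ - ⟦ j ⟧)) (inv (⟦ j ⟧ - ⟦ i ⟧)) (δ i j)))
    where
    distribute : ∀ u v I J a a′ d → u * v * (I * a + J * a′ + d) ≡ (u * I) * (v * a) + (v * J) * (u * a′) + d * (u * v)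
    distribute = solve-∀ ring
  first : ∑[ i < M ] ∑ N (X₁ i) ≡ ∑[ i < M ] (c m i * ⟦ i ⟧ * S n i)
  first = ∑-cong M (λ i _ → ∑-*ˡ (c m i * ⟦ i ⟧) (λ j → c n j * inv (⟦ i ⟧ - ⟦ j ⟧)) N)
  second : ∑[ i < M ] ∑ N (X₂ i) ≡ ∑[ j < N ] (c n j * ⟦ j ⟧ * S m j)
  second = trans (∑-comm X₂ M N) (∑-cong N (λ j _ → ∑-*ˡ (c n j * ⟦ j ⟧) (λ i → c m i * inv (⟦ j ⟧ - ⟦ i ⟧)) M))
  third : ∑[ i < M ] ∑ N (X₃ i) ≡ ∑[ j < N ] (c m j * c n j)
  third = trans (∑-comm X₃ M N) (∑-cong N (λ j j<N → ∑-δ (λ i → c m i * c n j) (ℕP.<-≤-trans j<N (s≤s n≤m))))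

diagonal : ℕ → ℕ → ℕ → ℚ
diagonal m n p = c m p * ⟦ p ⟧ * S n p + c n p * ⟦ p ⟧ * S m p + c m p * c n p

beyond : ℕ → ℕ → ℕ → ℚ
beyond m n x = c m x * ⟦ x ⟧ * S n x

1≡∑diagonal+∑beyond : ∀ {m n} → n ≤ m →
  1ℚ ≡ ∑[ p < suc n ] diagonal m n p + ∑[ k < m ∸ n ] beyond m n (suc n ℕ.+ k)
1≡∑diagonal+∑beyond {m} {n} n≤m = begin
  1ℚ                                               ≡⟨ ∑c*∑c-expand n≤m ⟩
  ∑ (suc m) (beyond m n) + ∑ (suc n) F₂ + ∑ (suc n) F₃
                                                   ≡⟨ cong (λ t → t + ∑ (suc n) F₂ + ∑ (suc n) F₃) split-at-n ⟩
  ∑ (suc n) (beyond m n) + Beyond + ∑ (suc n) F₂ + ∑ (suc n) F₃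
                                                   ≡⟨ rearrange (∑ (suc n) (beyond m n)) Beyond (∑ (suc n) F₂) (∑ (suc n) F₃) ⟩
  ∑ (suc n) (beyond m n) + ∑ (suc n) F₂ + ∑ (suc n) F₃ + Beyond
                                                   ≡⟨ cong (_+ Beyond) (sym (∑-+₃ (beyond m n) F₂ F₃ (suc n))) ⟩
  ∑ (suc n) (diagonal m n) + Beyond                ∎
  where
  open ≡-Reasoning
  F₂ F₃ : ℕ → ℚ
  F₂ j = c n j * ⟦ j ⟧ * S m j
  F₃ j = c m j * c n j
  Beyond = ∑[ k < m ∸ n ] beyond m n (suc n ℕ.+ k)
  split-at-n : ∑ (suc m) (beyond m n) ≡ ∑ (suc n) (beyond m n) + Beyond
  split-at-n = trans (cong (λ t → ∑ (suc t) (beyond m n)) (sym (ℕP.m+[n∸m]≡n n≤m))) (∑-split (beyond m n) (suc n) (m ∸ n))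
  rearrange : ∀ a b c d → a + b + c + d ≡ a + c + d + b
  rearrange = solve-∀ ring

diagonal≡term1 : ∀ {m n p} → p ≤ n → n ≤ m → neg1^ (m ℕ.+ n) * diagonal m n p ≡ term1 m n p
diagonal≡term1 {m} {n} {p} p≤n n≤m = begin
  σ * (cm * P * S n p + cn * P * S m p + cm * cn)
      ≡⟨ cong₂ (λ u v → σ * (cm * P * u + cn * P * v + cm * cn)) (S-at-pole p≤n) (S-at-pole (ℕP.≤-trans p≤n n≤m)) ⟩
  σ * (cm * P * (cn * E n p) + cn * P * (cm * E m p) + cm * cn)
      ≡⟨ factor σ cm cn P (E m p) (E n p) ⟩
  σ * (cm * cn) * (1ℚ + P * (E m p + E n p))
      ≡⟨ cong₂ _*_ (trans (cong (σ *_) (c*c≡±C p≤n n≤m)) (neg1^-cancel (m ℕ.+ n) _))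
                   (cong (λ t → 1ℚ + P * t) (harmonic (H (m ℕ.+ p)) (H (m ∸ p)) (H (n ℕ.+ p)) (H (n ∸ p)) (H p))) ⟩
  term1 m n p ∎
  where
  open ≡-Reasoning
  σ = neg1^ (m ℕ.+ n)
  cm = c m p
  cn = c n p
  P = ⟦ p ⟧
  factor : ∀ σ cm cn P Em En →
    σ * (cm * P * (cn * En) + cn * P * (cm * Em) + cm * cn) ≡ σ * (cm * cn) * (1ℚ + P * (Em + En))
  factor = solve-∀ ring
  harmonic : ∀ a b c d h → a + b - (h + h) + (c + d - (h + h)) ≡ a + b + c + d - (1ℚ + 1ℚ + 1ℚ + 1ℚ) * h
  harmonic = solve-∀ ring

x*V≡C*inv[C] : ∀ {n x} → n < x → ⟦ x ⟧ * V n x ≡ ⟦ (n ℕ.+ x) C x ⟧ * inv ⟦ (x ∸ 1) C n ⟧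
x*V≡C*inv[C] {n} {suc x} (s≤s n≤x) = linear-combination (certificate (⟦ suc x ⟧ * V n (suc x)) Cx D (inv Cx))
  (inv Cx ⊙ V-binomial (s≤s n≤x) ⊕ (- (⟦ suc x ⟧ * V n (suc x))) ⊙ inv-nonzero (k≤n⇒nCk≢0 n≤x))
  where
  Cx = ⟦ x C n ⟧
  D = ⟦ (n ℕ.+ suc x) C suc x ⟧
  certificate : ∀ XV Cx D iC → XV - D * iC ≡ iC * (XV * Cx - D) + (- XV) * (Cx * iC - 1ℚ)
  certificate = solve-∀ ring

beyond≡term2 : ∀ {m n x} → n < x → x ≤ m → neg1^ (m ℕ.+ n) * beyond m n x ≡ term2 m n x
beyond≡term2 {m} {n} {x} n<x x≤m = begin
  σ * (c m x * X * S n x)                        ≡⟨ cong₂ (λ u v → σ * (u * X * v)) (c-def m x) (S≡V n<x) ⟩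
  σ * (s₁ * (A₁ * A₂) * X * V n x)               ≡⟨ cong (σ *_) (*-assoc (s₁ * (A₁ * A₂)) X (V n x)) ⟩
  σ * (s₁ * (A₁ * A₂) * (X * V n x))             ≡⟨ cong₂ (λ u v → u * (s₁ * (A₁ * A₂) * v)) sign (x*V≡C*inv[C] n<x) ⟩
  s₁ * s₂ * (s₁ * (A₁ * A₂) * (A₃ * inv Cx))     ≡⟨ regroup s₁ s₂ A₁ A₂ A₃ (inv Cx) ⟩
  s₁ * (s₁ * (s₂ * (A₁ * A₂ * A₃) * inv Cx))     ≡⟨ neg1^-cancel (m ∸ x) _ ⟩
  s₂ * (A₁ * A₂ * A₃) * inv Cx                   ≡⟨ cong (λ t → s₂ * t * inv Cx) (sym product) ⟩
  s₂ * ⟦ ((m ℕ.+ x) C x) ℕ.* (m C x) ℕ.* ((n ℕ.+ x) C x) ⟧ * inv Cx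
                                                 ≡⟨ sym (÷ℕ≡*inv _ ((x ∸ 1) C n)) ⟩
  term2 m n x                                    ∎
  where
  open ≡-Reasoning
  σ = neg1^ (m ℕ.+ n)
  s₁ = neg1^ (m ∸ x)
  s₂ = neg1^ (x ∸ n)
  X = ⟦ x ⟧
  A₁ = ⟦ (m ℕ.+ x) C x ⟧
  A₂ = ⟦ m C x ⟧
  A₃ = ⟦ (n ℕ.+ x) C x ⟧
  Cx = ⟦ (x ∸ 1) C n ⟧
  regroup : ∀ s t a b c i → s * t * (s * (a * b) * (c * i)) ≡ s * (s * (t * (a * b * c) * i))
  regroup = solve-∀ ring
  product : ⟦ ((m ℕ.+ x) C x) ℕ.* (m C x) ℕ.* ((n ℕ.+ x) C x) ⟧ ≡ A₁ * A₂ * A₃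
  product = trans (⟦⟧-homo-* (((m ℕ.+ x) C x) ℕ.* (m C x)) ((n ℕ.+ x) C x)) (cong (_* A₃) (⟦⟧-homo-* ((m ℕ.+ x) C x) (m C x)))
  sign : σ ≡ s₁ * s₂
  sign = trans (neg1^-parity (m ∸ x ℕ.+ (x ∸ n)) n parity) (neg1^-+ (m ∸ x) (x ∸ n))
    where
    n≤x = ℕP.<⇒≤ n<x
    regroup′ : ∀ a b n → (a ℕ.+ (b ℕ.+ n)) ℕ.+ n ≡ a ℕ.+ b ℕ.+ (n ℕ.+ n)
    regroup′ = ℕ-solve-∀
    parity : m ℕ.+ n ≡ (m ∸ x) ℕ.+ (x ∸ n) ℕ.+ (n ℕ.+ n)
    parity = trans (cong (ℕ._+ n) (trans (sym (ℕP.m∸n+n≡m x≤m)) (cong ((m ∸ x) ℕ.+_) (sym (ℕP.m∸n+n≡m n≤x)))))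
                   (regroup′ (m ∸ x) (x ∸ n) n)

corollary3p2 : (m n : ℕ) → 1 ≤ n → n ≤ m →
    neg1^ (m Data.Nat.+ n) ≡ sumFromTo 0 n (term1 m n) + sumFromTo (suc n) m (term2 m n)
corollary3p2 m n _ n≤m = begin
  σ                                                                  ≡⟨ sym (*-identityʳ σ) ⟩
  σ * 1ℚ                                                             ≡⟨ cong (σ *_) (1≡∑diagonal+∑beyond n≤m) ⟩
  σ * (∑ (suc n) (diagonal m n) + ∑ (m ∸ n) beyond′)                  ≡⟨ *-distribˡ-+ σ _ _ ⟩
  σ * ∑ (suc n) (diagonal m n) + σ * ∑ (m ∸ n) beyond′               ≡⟨ cong₂ _+_ (sym (∑-*ˡ σ (diagonal m n) (suc n)))
                                                                                   (sym (∑-*ˡ σ beyond′ (m ∸ n))) ⟩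
  ∑[ p < suc n ] (σ * diagonal m n p) + ∑[ k < m ∸ n ] (σ * beyond′ k)
      ≡⟨ cong₂ _+_ (∑-cong (suc n) (λ p p<N → diagonal≡term1 (ℕP.≤-pred p<N) n≤m))
                   (∑-cong (m ∸ n) (λ k k<m-n → beyond≡term2 (s≤s (ℕP.m≤m+n n k)) (k<m∸n⇒1+n+k≤m k<m-n))) ⟩
  ∑ (suc n) (term1 m n) + ∑[ k < m ∸ n ] term2 m n (suc n ℕ.+ k)     ≡⟨ sym (cong₂ _+_ (sumFromTo≡∑ 0 n (term1 m n))
                                                                                        (sumFromTo≡∑ (suc n) m (term2 m n))) ⟩
  sumFromTo 0 n (term1 m n) + sumFromTo (suc n) m (term2 m n)        ∎
  where
  open ≡-Reasoning
  σ = neg1^ (m ℕ.+ n)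
  beyond′ : ℕ → ℚ
  beyond′ k = beyond m n (suc n ℕ.+ k)
  k<m∸n⇒1+n+k≤m : ∀ {k} → k < m ∸ n → suc n ℕ.+ k ≤ m
  k<m∸n⇒1+n+k≤m k<m-n = subst (suc n ℕ.+ _ ≤_) (ℕP.m+[n∸m]≡n n≤m) (ℕP.+-monoʳ-< n k<m-n)
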